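{- Let $S\subseteq E^n$ and let $A=\{a_1,\dots,a_k\}\subseteq S$ with $k\geq 1$. Then $$D(S)=\sum_{f\in M(A)} D\bigl(S-S_{A,(f(a_1),\dots,f(a_k))}\bigr),$$ a sum with exactly $D(A)=|M(A)|$ terms.
   Context: $E=\{0,1\}$ with $0\leq 1$. $E^n$ is the set of $n$-tuples $a=(a^1,\dots,a^n)$ with $a^i\in E$, ordered componentwise: $a\leq b$ iff $a^i\leq b^i$ for all $i$. A monotone Boolean function is a map $f:E^n\to E$ with $a\leq b\Rightarrow f(a)\leq f(b)$. For $S\subseteq E^n$, $M(S)$ denotes the set of all distinct restrictions $f|_S$ of monotone Boolean functions $f:E^n\to E$ to $S$, and $D(S)=|M(S)|$ (the local Dedekind number on $S$); for $f\in M(A)$ the values $f(a_i)$ are those of the restriction. For $a\in E^n$: $S_{a,1}=\{b\in E^n: b\geq a\}$ and $S_{a,0}=\{b\in E^n: b\leq a\}$. For $A=\{a_1,\dots,a_k\}\subseteq E^n$ and $y=(y^1,\dots,y^k)\in E^k$: $S_{A,y}=\bigcup_{i=1}^k S_{a_i,y^i}$. -}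

module Defs where

open import Level using (0ℓ)
open import Data.Bool using (Bool; true; false)
import Data.Bool as B
open import Data.Bool.Properties using () renaming (_≟_ to _≟B_; _≤?_ to _≤B?_)
open import Data.Nat using (ℕ; zero; suc)
open import Data.Vec using (Vec; []; _∷_)
open import Data.Vec.Relation.Binary.Pointwise.Inductive as PW using (Pointwise)
open import Data.List using (List; []; _∷_; map; filter; deduplicate; length; zip; concatMap; _++_)
open import Data.List.Properties using (≡-dec)
open import Data.List.Relation.Unary.All as All using (All)
open import Data.List.Relation.Unary.Any as Any using (Any)
open import Data.List.Membership.Propositional using (_∈_)
open import Data.List.Membership.Propositional.Properties using (∈-++⁺ˡ; ∈-++⁺ʳ; ∈-map⁺)
open import Data.Product using (_×_; _,_; ∃-syntax; Σ-syntax)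
open import Relation.Nullary using (Dec; yes; no; ¬_; ¬?)
open import Relation.Nullary.Decidable using (_→-dec_)
open import Relation.Binary.PropositionalEquality using (_≡_; refl)

E : Set
E = Bool

Point : ℕ → Set
Point n = Vec E n

_≤ᵖ_ : ∀ {n} → Point n → Point n → Set
_≤ᵖ_ = Pointwise B._≤_

_≤ᵖ?_ : ∀ {n} (a b : Point n) → Dec (a ≤ᵖ b)
_≤ᵖ?_ = PW.decidable _≤B?_

Monotone : ∀ {n} → (Point n → E) → Set
Monotone f = ∀ a b → a ≤ᵖ b → f a B.≤ f b

points : (n : ℕ) → List (Point n)
points zero = [] ∷ []
points (suc n) = map (false ∷_) (points n) ++ map (true ∷_) (points n)

points-complete : ∀ {n} (v : Point n) → v ∈ points n
points-complete [] = Any.here refl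
points-complete {suc n} (false ∷ v) = ∈-++⁺ˡ (∈-map⁺ (false ∷_) (points-complete v))
points-complete {suc n} (true ∷ v) =
  ∈-++⁺ʳ (map (false ∷_) (points n)) (∈-map⁺ (true ∷_) (points-complete v))

monotone? : ∀ {n} (f : Point n → E) → Dec (Monotone f)
monotone? {n} f with All.all? (λ a → All.all? (λ b → (a ≤ᵖ? b) →-dec (f a ≤B? f b)) (points n)) (points n)
... | yes p = yes (λ a b a≤b → All.lookup (All.lookup p (points-complete a)) (points-complete b) a≤b)
... | no ¬p = no (λ m → ¬p (All.tabulate (λ {a} _ → All.tabulate (λ {b} _ → m a b))))

-- all functions E^n → E (every function agrees pointwise with one in this list)
allFuns : (n : ℕ) → List (Point n → E)
allFuns zero = (λ _ → false) ∷ (λ _ → true) ∷ []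
allFuns (suc n) = concatMap (λ g → map (λ h → step g h) (allFuns n)) (allFuns n)
  where
  step : (Point n → E) → (Point n → E) → Point (suc n) → E
  step g h (false ∷ v) = g v
  step g h (true ∷ v) = h v

monotoneFuns : (n : ℕ) → List (Point n → E)
monotoneFuns n = filter monotone? (allFuns n)

-- A subset S ⊆ E^n is represented by a duplicate-free list of its points.
-- The restriction f|_S is recorded as the list of values of f along S.
restrict : ∀ {n} → List (Point n) → (Point n → E) → List E
restrict S f = map f S

M : ∀ {n} → List (Point n) → List (List E)
M {n} S = deduplicate (≡-dec _≟B_) (map (restrict S) (monotoneFuns n))

D : ∀ {n} → List (Point n) → ℕ
D S = length (M S)

S-at : ∀ {n} → Point n → E → Point n → Set
S-at a true b = a ≤ᵖ b
S-at a false b = b ≤ᵖ a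

S-at? : ∀ {n} (a : Point n) (y : E) (b : Point n) → Dec (S-at a y b)
S-at? a true b = a ≤ᵖ? b
S-at? a false b = b ≤ᵖ? a

InSAy : ∀ {n} → List (Point n) → List E → Point n → Set
InSAy A y b = Any (λ p → S-at (Data.Product.proj₁ p) (Data.Product.proj₂ p) b) (zip A y)

InSAy? : ∀ {n} (A : List (Point n)) (y : List E) (b : Point n) → Dec (InSAy A y b)
InSAy? A y b = Any.any? (λ p → S-at? (Data.Product.proj₁ p) (Data.Product.proj₂ p) b) (zip A y)

_minusSAy_,_ : ∀ {n} → List (Point n) → List (Point n) → List E → List (Point n)
S minusSAy A , y = filter (λ b → ¬? (InSAy? A y b)) S

-- Group the monotone f by their restriction y = f|A.  Monotonicity forces f on S_{A,y}: there
-- f b = 1 exactly when b ≥ a_i for some i with y^i = 1.  Conversely, for every y, filling in these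
-- forced values around a monotone h on S − S_{A,y} gives a monotone function, since the points
-- forced to 1 form an up-set inside S_{A,y} and the remaining points of S_{A,y} lie in the down-set
-- ⋃_{y^i = 0} S_{a_i,0}.  So M(S) is the union over y ∈ M(A) of copies of M(S − S_{A,y}), and the
-- union is disjoint because A ⊆ S lets one read y back off an element of M(S).

module Submission where

open import Defs
open import Data.Nat using (ℕ; _≤_)
open import Data.List using (List; map; length)
open import Data.Nat.ListAction using (sum)
open import Data.List.Relation.Unary.All using (All)
open import Data.List.Relation.Unary.Unique.Propositional using (Unique)
open import Data.List.Membership.Propositional using (_∈_)
open import Data.Product using (_×_)
open import Relation.Binary.PropositionalEquality using (_≡_)

open import Data.Bool using (true; false; if_then_else_)
import Data.Bool as B
import Data.Bool.Properties as Bₚ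
open import Data.Bool.Properties using (≤-minimum; ≤-maximum) renaming (_≟_ to _≟B_)
open import Data.Nat using (zero; suc; _+_)
open import Data.List using ([]; _∷_; zip; concatMap)
open import Data.List.Properties using (≡-dec; length-++; length-map; map-cong; map-cong-local; ∷-injective)
open import Data.List.Relation.Unary.Any as Any using (Any; here; there)
import Data.List.Relation.Unary.Any.Properties as Anyₚ
import Data.List.Relation.Unary.All as All
import Data.List.Relation.Unary.All.Properties as Allₚ
open import Data.List.Relation.Unary.All using ([]; _∷_)
open import Data.List.Relation.Unary.AllPairs using ([]; _∷_)
import Data.List.Relation.Unary.Unique.Propositional.Properties as Uniqueₚ
open import Data.List.Relation.Unary.Unique.DecPropositional.Properties (≡-dec _≟B_) using (deduplicate-!)
open import Data.List.Membership.Propositional using (find; lose)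
open import Data.List.Membership.Propositional.Properties
  using (∈-map⁺; ∈-map⁻; ∈-concatMap⁺; ∈-concatMap⁻; ∈-filter⁺; ∈-filter⁻; ∈-deduplicate⁺; ∈-deduplicate⁻)
open import Data.List.Membership.Propositional.Properties.WithK using (unique∧set⇒bag)
open import Data.List.Relation.Binary.BagAndSetEquality using (∼bag⇒↭)
open import Data.List.Relation.Binary.Permutation.Propositional.Properties using (↭-length)
open import Data.Vec using ([]; _∷_)
import Data.Vec.Relation.Binary.Pointwise.Inductive as Pointwise
open import Data.Product using (_,_; proj₂; ∃-syntax)
open import Data.Empty using (⊥-elim)
open import Function using (_∘_; mk⇔)
open import Relation.Nullary using (Dec; ¬_; yes; no; does)
open import Relation.Nullary.Decidable using (_×-dec_; dec-true; dec-false)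
open import Relation.Binary.PropositionalEquality
  using (module ≡-Reasoning; refl; sym; trans; cong; subst; subst₂; _≗_)
open ≡-Reasoning

module _ {a b} {X : Set a} {Y : Set b} where

  length-concatMap : ∀ (F : X → List Y) xs → length (concatMap F xs) ≡ sum (map (length ∘ F) xs)
  length-concatMap F [] = refl
  length-concatMap F (x ∷ xs) = trans (length-++ (F x)) (cong (length (F x) +_) (length-concatMap F xs))

  map-cong-local⁻ : ∀ {f g : X → Y} xs → map f xs ≡ map g xs → All (λ x → f x ≡ g x) xs
  map-cong-local⁻ [] _ = []
  map-cong-local⁻ (x ∷ xs) eq with ∷-injective eq
  ... | fx≡gx , eqs = fx≡gx ∷ map-cong-local⁻ xs eqs

  Any-zip-map⁺ : ∀ {p} {P : X × Y → Set p} {f : X → Y} xs →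
                 Any (λ x → P (x , f x)) xs → Any P (zip xs (map f xs))
  Any-zip-map⁺ (x ∷ xs) (here px) = here px
  Any-zip-map⁺ (x ∷ xs) (there pxs) = there (Any-zip-map⁺ xs pxs)

  Any-zip-map⁻ : ∀ {p} {P : X × Y → Set p} {f : X → Y} xs →
                 Any P (zip xs (map f xs)) → Any (λ x → P (x , f x)) xs
  Any-zip-map⁻ (x ∷ xs) (here px) = here px
  Any-zip-map⁻ (x ∷ xs) (there pxs) = there (Any-zip-map⁻ xs pxs)

  unique-map⁺-local : ∀ {f : X → Y} {xs} → (∀ {x x'} → x ∈ xs → x' ∈ xs → f x ≡ f x' → x ≡ x') →
                      Unique xs → Unique (map f xs)
  unique-map⁺-local _ [] = []
  unique-map⁺-local inj (x∉xs ∷ xs!) =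
    Allₚ.map⁺ (All.tabulate λ x'∈ fx≡fx' → All.lookup x∉xs x'∈ (inj (here refl) (there x'∈) fx≡fx'))
    ∷ unique-map⁺-local (λ p q → inj (there p) (there q)) xs!

  unique-concatMap⁺ : ∀ (F : X → List Y) {xs} → Unique xs → (∀ {x} → x ∈ xs → Unique (F x)) →
                      (∀ {x x' z} → x ∈ xs → x' ∈ xs → z ∈ F x → z ∈ F x' → x ≡ x') →
                      Unique (concatMap F xs)
  unique-concatMap⁺ F [] _ _ = []
  unique-concatMap⁺ F {x ∷ xs} (x∉xs ∷ xs!) F! disjoint =
    Uniqueₚ.++⁺ (F! (here refl))
                (unique-concatMap⁺ F xs! (F! ∘ there) (λ p q → disjoint (there p) (there q)))
                F-disjoint
    where
    F-disjoint : ∀ {z} → ¬ (z ∈ F x × z ∈ concatMap F xs)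
    F-disjoint (z∈Fx , z∈rest) with find (∈-concatMap⁻ F {xs = xs} z∈rest)
    ... | x' , x'∈ , z∈Fx' = All.lookup x∉xs x'∈ (disjoint (here refl) (there x'∈) z∈Fx z∈Fx')

module _ {a} {X : Set a} where

  unique∧set⇒length≡ : ∀ {xs ys : List X} → Unique xs → Unique ys →
                       (∀ {x} → x ∈ xs → x ∈ ys) → (∀ {x} → x ∈ ys → x ∈ xs) → length xs ≡ length ys
  unique∧set⇒length≡ xs! ys! xs⊆ys ys⊆xs = ↭-length (∼bag⇒↭ (unique∧set⇒bag xs! ys! (mk⇔ xs⊆ys ys⊆xs)))

≤ᵖ-refl : ∀ {n} {a : Point n} → a ≤ᵖ a
≤ᵖ-refl = Pointwise.refl Bₚ.≤-refl

≤ᵖ-trans : ∀ {n} {a b c : Point n} → a ≤ᵖ b → b ≤ᵖ c → a ≤ᵖ c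
≤ᵖ-trans = Pointwise.trans Bₚ.≤-trans

allFuns-complete : ∀ n (g : Point n → E) → Any (_≗ g) (allFuns n)
allFuns-complete zero g with g [] in g[]
... | false = here λ { [] → sym g[] }
... | true = there (here λ { [] → sym g[] })
allFuns-complete (suc n) g =
  Anyₚ.concatMap⁺ _
    (Any.map (λ g₀≗ → Anyₚ.map⁺ (Any.map (λ g₁≗ → λ { (false ∷ v) → g₀≗ v ; (true ∷ v) → g₁≗ v })
                                         (allFuns-complete n (g ∘ (true ∷_)))))
             (allFuns-complete n (g ∘ (false ∷_))))

Monotone-resp-≗ : ∀ {n} {f g : Point n → E} → f ≗ g → Monotone g → Monotone f
Monotone-resp-≗ f≗g g-mono a b a≤b = subst₂ B._≤_ (sym (f≗g a)) (sym (f≗g b)) (g-mono a b a≤b)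

true-upward : ∀ {n} {f : Point n → E} → Monotone f → ∀ {a b} → f a ≡ true → a ≤ᵖ b → f b ≡ true
true-upward {f = f} f-mono {a} {b} fa≡true a≤b =
  Bₚ.≤-antisym (≤-maximum (f b)) (subst (B._≤ f b) fa≡true (f-mono a b a≤b))

module _ {n} (S : List (Point n)) where

  M-unique : Unique (M S)
  M-unique = deduplicate-! _

  ∈M⁺ : ∀ {f} → Monotone f → map f S ∈ M S
  ∈M⁺ {f} f-mono with find (allFuns-complete n f)
  ... | g , g∈ , g≗f =
    ∈-deduplicate⁺ (≡-dec _≟B_)
      (subst (_∈ map (restrict S) (monotoneFuns n)) (map-cong g≗f S)
        (∈-map⁺ (restrict S) (∈-filter⁺ monotone? g∈ (Monotone-resp-≗ g≗f f-mono))))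

  ∈M⁻ : ∀ {x} → x ∈ M S → ∃[ f ] Monotone f × x ≡ map f S
  ∈M⁻ x∈ with ∈-map⁻ (restrict S) (∈-deduplicate⁻ (≡-dec _≟B_) _ x∈)
  ... | f , f∈ , x≡ = f , proj₂ (∈-filter⁻ monotone? {xs = allFuns n} f∈) , x≡

module _ {n} (A : List (Point n)) (y : List E) where

  Forced : Point n → Set
  Forced b = Any (λ (a , v) → v ≡ true × a ≤ᵖ b) (zip A y)

  Forced? : ∀ b → Dec (Forced b)
  Forced? b = Any.any? (λ (a , v) → (v ≟B true) ×-dec (a ≤ᵖ? b)) (zip A y)

  forced : Point n → E
  forced b = does (Forced? b)

  extend : (Point n → E) → Point n → E
  extend h b = if does (InSAy? A y b) then forced b else h b

  Forced-upward : ∀ {b b'} → Forced b → b ≤ᵖ b' → Forced b'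
  Forced-upward forced-b b≤b' = Any.map (λ (v≡true , a≤b) → v≡true , ≤ᵖ-trans a≤b b≤b') forced-b

  Forced⇒InSAy : ∀ {b} → Forced b → InSAy A y b
  Forced⇒InSAy = Any.map λ { {_ , .true} (refl , a≤b) → a≤b }

  unforced-InSAy-downward : ∀ {b b'} → InSAy A y b' → ¬ Forced b' → b ≤ᵖ b' → InSAy A y b
  unforced-InSAy-downward inside unforced b≤b' with find inside
  ... | (a , true) , a∈ , a≤b' = ⊥-elim (unforced (lose a∈ (refl , a≤b')))
  ... | (a , false) , a∈ , b'≤a = lose a∈ (≤ᵖ-trans b≤b' b'≤a)

  forced-monotone : Monotone forced
  forced-monotone b b' b≤b' with Forced? b | Forced? b'
  ... | yes forced-b | no unforced' = ⊥-elim (unforced' (Forced-upward forced-b b≤b'))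
  ... | yes _ | yes _ = Bₚ.≤-refl
  ... | no _ | _ = ≤-minimum _

  extend-monotone : ∀ {h} → Monotone h → Monotone (extend h)
  extend-monotone {h} h-mono b b' b≤b' with InSAy? A y b | InSAy? A y b'
  ... | yes _ | yes _ = forced-monotone b b' b≤b'
  ... | no _ | no _ = h-mono b b' b≤b'
  ... | yes _ | no outside' with Forced? b
  ...   | yes forced-b = ⊥-elim (outside' (Forced⇒InSAy (Forced-upward forced-b b≤b')))
  ...   | no _ = ≤-minimum (h b')
  extend-monotone {h} h-mono b b' b≤b' | no outside | yes inside' with Forced? b'
  ...   | yes _ = ≤-maximum (h b)
  ...   | no unforced' = ⊥-elim (outside (unforced-InSAy-downward inside' unforced' b≤b'))

  extend-inside : ∀ h {b} → InSAy A y b → extend h b ≡ forced b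
  extend-inside h {b} inside with InSAy? A y b
  ... | yes _ = refl
  ... | no outside = ⊥-elim (outside inside)

  extend-outside : ∀ h {b} → ¬ InSAy A y b → extend h b ≡ h b
  extend-outside h {b} outside with InSAy? A y b
  ... | yes inside = ⊥-elim (outside inside)
  ... | no _ = refl

  -- fill S zs reads zs as the values along S − S_{A,y}; the [] clause is junk for shorter zs.
  fill : List (Point n) → List E → List E
  fill [] _ = []
  fill (b ∷ S) zs with InSAy? A y b
  ... | yes _ = forced b ∷ fill S zs
  fill (b ∷ S) [] | no _ = []
  fill (b ∷ S) (z ∷ zs) | no _ = z ∷ fill S zs

  fill-map : ∀ h S → fill S (map h (S minusSAy A , y)) ≡ map (extend h) S
  fill-map h [] = refl
  fill-map h (b ∷ S) with InSAy? A y b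
  ... | yes _ = cong (forced b ∷_) (fill-map h S)
  ... | no _ = cong (h b ∷_) (fill-map h S)

module _ {n} (A : List (Point n)) {f : Point n → E} (f-mono : Monotone f) where

  forced-restriction : ∀ {b} → InSAy A (map f A) b → forced A (map f A) b ≡ f b
  forced-restriction {b} inside with f b in fb≡
  ... | true =
    dec-true (Forced? A (map f A) b) (Any-zip-map⁺ A (Any.map (λ {a} → forcing a) (Any-zip-map⁻ A inside)))
    where
    forcing : ∀ a → S-at a (f a) b → f a ≡ true × a ≤ᵖ b
    forcing a a-b with f a in fa≡
    ... | true = refl , a-b
    ... | false with () ← trans (sym fa≡) (true-upward f-mono fb≡ a-b)
  ... | false = dec-false (Forced? A (map f A) b) (unforced ∘ Any.satisfied ∘ Any-zip-map⁻ A)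
    where
    unforced : ¬ (∃[ a ] f a ≡ true × a ≤ᵖ b)
    unforced (a , fa≡ , a≤b) with () ← trans (sym fb≡) (true-upward f-mono fa≡ a≤b)

  InSAy-restriction : ∀ {a} → a ∈ A → InSAy A (map f A) a
  InSAy-restriction a∈ = Any-zip-map⁺ A (Any.map (λ { refl → S-at-refl _ _ }) a∈)
    where
    S-at-refl : ∀ a v → S-at a v a
    S-at-refl a true = ≤ᵖ-refl
    S-at-refl a false = ≤ᵖ-refl

  extend-restriction-at-A : ∀ h {a} → a ∈ A → extend A (map f A) h a ≡ f a
  extend-restriction-at-A h a∈ =
    trans (extend-inside A (map f A) h (InSAy-restriction a∈)) (forced-restriction (InSAy-restriction a∈))

  extend-restriction : extend A (map f A) f ≗ f
  extend-restriction b with InSAy? A (map f A) b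
  ... | yes inside = forced-restriction inside
  ... | no _ = refl

module _ {n} (S A : List (Point n)) where

  lift : List E → List (List E)
  lift y = map (fill A y S) (M (S minusSAy A , y))

  glued : List (List E)
  glued = concatMap lift (M A)

  ∈lift⁻ : ∀ {y x} → x ∈ lift y → ∃[ h ] Monotone h × x ≡ map (extend A y h) S
  ∈lift⁻ {y} x∈ with ∈-map⁻ (fill A y S) x∈
  ... | zs , zs∈ , refl with ∈M⁻ _ zs∈
  ... | h , h-mono , refl = h , h-mono , fill-map A y h S

  glued⊆M : ∀ {x} → x ∈ glued → x ∈ M S
  glued⊆M x∈ with find (∈-concatMap⁻ lift {xs = M A} x∈)
  ... | y , _ , x∈lift with ∈lift⁻ x∈lift
  ... | h , h-mono , refl = ∈M⁺ S (extend-monotone A y h-mono)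

  M⊆glued : ∀ {x} → x ∈ M S → x ∈ glued
  M⊆glued x∈ with ∈M⁻ S x∈
  ... | f , f-mono , refl = ∈-concatMap⁺ lift {xs = M A} (Any.map (λ { refl → f∈lift }) (∈M⁺ A f-mono))
    where
    f∈lift : map f S ∈ lift (map f A)
    f∈lift = subst (_∈ lift (map f A))
                   (trans (fill-map A (map f A) f S) (map-cong (extend-restriction A f-mono) S))
                   (∈-map⁺ _ (∈M⁺ _ f-mono))

  lift-unique : ∀ y → Unique (lift y)
  lift-unique y = unique-map⁺-local fill-injective (M-unique _)
    where
    fill-injective : ∀ {zs zs'} → zs ∈ M (S minusSAy A , y) → zs' ∈ M (S minusSAy A , y) →
                     fill A y S zs ≡ fill A y S zs' → zs ≡ zs'
    fill-injective zs∈ zs'∈ eq with ∈M⁻ _ zs∈ | ∈M⁻ _ zs'∈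
    ... | h , _ , refl | h' , _ , refl = map-cong-local (All.tabulate agree)
      where
      extensions-agree : All (λ b → extend A y h b ≡ extend A y h' b) S
      extensions-agree = map-cong-local⁻ S (trans (sym (fill-map A y h S)) (trans eq (fill-map A y h' S)))

      agree : ∀ {b} → b ∈ S minusSAy A , y → h b ≡ h' b
      agree {b} b∈ with ∈-filter⁻ _ {xs = S} b∈
      ... | b∈S , outside = begin
        h b             ≡⟨ extend-outside A y h outside ⟨
        extend A y h b  ≡⟨ All.lookup extensions-agree b∈S ⟩
        extend A y h' b ≡⟨ extend-outside A y h' outside ⟩
        h' b            ∎

  lift-disjoint : All (_∈ S) A → ∀ {y y' x} → y ∈ M A → y' ∈ M A → x ∈ lift y → x ∈ lift y' → y ≡ y'
  lift-disjoint A⊆S y∈ y'∈ x∈ x∈' with ∈M⁻ A y∈ | ∈M⁻ A y'∈ | ∈lift⁻ x∈ | ∈lift⁻ x∈'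
  ... | f , f-mono , refl | f' , f'-mono , refl | h , _ , refl | h' , _ , eq =
    map-cong-local (All.tabulate agree)
    where
    extensions-agree : All (λ b → extend A (map f A) h b ≡ extend A (map f' A) h' b) S
    extensions-agree = map-cong-local⁻ S eq

    agree : ∀ {a} → a ∈ A → f a ≡ f' a
    agree {a} a∈ = begin
      f a                      ≡⟨ extend-restriction-at-A A f-mono h a∈ ⟨
      extend A (map f A) h a   ≡⟨ All.lookup extensions-agree (All.lookup A⊆S a∈) ⟩
      extend A (map f' A) h' a ≡⟨ extend-restriction-at-A A f'-mono h' a∈ ⟩
      f' a                     ∎

  D-decomposition : All (_∈ S) A → D S ≡ sum (map (λ y → D (S minusSAy A , y)) (M A))
  D-decomposition A⊆S = begin
    length (M S)                                 ≡⟨ unique∧set⇒length≡ (M-unique S) glued-unique M⊆glued glued⊆M ⟩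
    length glued                                 ≡⟨ length-concatMap lift (M A) ⟩
    sum (map (length ∘ lift) (M A))              ≡⟨ cong sum (map-cong length-lift (M A)) ⟩
    sum (map (λ y → D (S minusSAy A , y)) (M A)) ∎
    where
    length-lift : ∀ y → length (lift y) ≡ D (S minusSAy A , y)
    length-lift y = length-map (fill A y S) (M (S minusSAy A , y))

    glued-unique : Unique glued
    glued-unique = unique-concatMap⁺ lift (M-unique A) (λ _ → lift-unique _) (lift-disjoint A⊆S)

theorem1 : ∀ {n : ℕ} (S A : List (Point n)) → Unique S → Unique A → All (_∈ S) A → 1 ≤ length A →
    (D S ≡ sum (map (λ y → D (S minusSAy A , y)) (M A)))
      × (length (map (λ y → D (S minusSAy A , y)) (M A)) ≡ D A)
theorem1 S A _ _ A⊆S _ = D-decomposition S A A⊆S , length-map _ (M A)
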